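{- Let $k, n \ge 1$ and let $B^*$ be a subdivision of $B_n$ properly coloured by colours in $[k]$ and rooted at the root of $B_n$. Then $\mathrm{Saff}(B^*)$ has at least $\sum_{i=1}^{k}\sum_{j=0}^{a_i-1} 2^j$ nicely coloured vertices, for some non-negative integers $a_1,\dots,a_k$ with $\sum_{i=1}^k a_i = n$.
   Context: $B_n$ is the complete binary tree with $n$ layers. A subdivision of a graph is obtained by replacing some edges with paths. A rooted binary tree: every vertex has at most two children (sons). "Properly coloured": coloured by a parity vertex colouring, i.e. every non-empty simple path contains some colour an odd number of times. $T_u$ is the subtree of $T$ rooted at $u$ consisting of $u$ and its descendants. A subtree $T'$ of rooted $T$ is compatible if rooted at its vertex closest to the root of $T$. A vertex is branched if it has at least two children. A nicely coloured tree is a properly coloured rooted binary tree whose root, branched vertices and leaves share one colour $c$ (nice colour); its nicely coloured vertices are those of colour $c$. A safflower of disjoint nicely coloured trees $T_1,\dots,T_n$ (roots $r_1,\dots,r_n$, nice colours possibly different) is the tree obtained by adding edges $r_ir_{i+1}$ (the path $(r_1,\dots,r_n)$ is the stem), rooted at $r_1$, provided its colouring is a parity vertex colouring; $T_1,\dots,T_n$ are its original trees; its nicely coloured vertices are those of its original trees. For $i\in[k]$, $G_i(T)$ is a fixed choice of compatible subtree of $T$ which is nicely coloured with nice colour $i$ and has the maximum number $g_i(T)$ of nicely coloured vertices ($g_i(T)=0$ if none exists). The main safflower subgraph $\mathrm{Saff}(T)$ of $T$ with root $r$ of colour $c$ is defined recursively: (1) if $T=\{r\}$, $\mathrm{Saff}(T)$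 is the single vertex $r$; (2) if $r$ has exactly one son $s$, $\mathrm{Saff}(T)$ is obtained by joining the one-vertex tree $\{r\}$ to $\mathrm{Saff}(T_s)$ by the edge $rs$, with original trees $\{r\}$ followed by those of $\mathrm{Saff}(T_s)$; (3) if $r$ has two sons, name them $s,t$ so that $g_c(T_s)\ge g_c(T_t)$ (arbitrarily on ties), let $G$ consist of $r$, $G_c(T_s)$ and the path in $T$ joining $r$ to the root of $G_c(T_s)$, and let $\mathrm{Saff}(T)$ be obtained by joining $G$ to $\mathrm{Saff}(T_t)$ by the edge $rt$, with original trees $G$ followed by those of $\mathrm{Saff}(T_t)$. -}

module Defs where

open import Data.Nat using (ℕ; zero; suc; _+_; _^_; _≤_; _%_)
open import Data.Fin using (Fin; zero; suc)
open import Data.Fin.Properties using (_≟_)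
open import Data.List using (List; []; _∷_; [_]; _++_; reverse)
open import Data.Maybe using (Maybe; just; nothing)
open import Data.Product using (Σ; ∃; _×_; _,_)
open import Data.Sum using (_⊎_)
open import Relation.Nullary using (¬_; yes; no)
open import Relation.Binary.PropositionalEquality using (_≡_)
open import Data.Unit using (⊤)
open import Data.Empty using (⊥)

data Tree (k : ℕ) : Set where
  leaf   : Fin k → Tree k
  unary  : Fin k → Tree k → Tree k
  binary : Fin k → Tree k → Tree k → Tree k

module _ {k : ℕ} where

  col : Tree k → Fin k
  col (leaf c)       = c
  col (unary c _)    = c
  col (binary c _ _) = c

  ind : Fin k → Fin k → ℕ
  ind i j with i ≟ j
  ... | yes _ = 1
  ... | no  _ = 0

  countCol : Fin k → Tree k → ℕ
  countCol i (leaf c)       = ind i c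
  countCol i (unary c t)    = ind i c + countCol i t
  countCol i (binary c l r) = ind i c + countCol i l + countCol i r

  occ : Fin k → List (Fin k) → ℕ
  occ i []       = 0
  occ i (x ∷ xs) = ind i x + occ i xs

  -- Desc t u : a vertex v of t, given by the path from the root, with T_v = u.

  data Desc : Tree k → Tree k → Set where
    here : ∀ {t} → Desc t t
    dn   : ∀ {c t u} → Desc t u → Desc (unary c t) u
    dl   : ∀ {c l r u} → Desc l u → Desc (binary c l r) u
    dr   : ∀ {c l r u} → Desc r u → Desc (binary c l r) u

  -- number of vertices of colour i on the descent path, from the root of t
  -- (inclusive) down to the vertex v (exclusive)
  descCount : ∀ {t u} → Fin k → Desc t u → ℕ
  descCount i here = 0
  descCount i (dn {c} d) = ind i c + descCount i d
  descCount i (dl {c} d) = ind i c + descCount i d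
  descCount i (dr {c} d) = ind i c + descCount i d

  data DownPath : Tree k → List (Fin k) → Set where
    stop : ∀ {t} → DownPath t [ col t ]
    pn   : ∀ {c t xs} → DownPath t xs → DownPath (unary c t) (c ∷ xs)
    pl   : ∀ {c l r xs} → DownPath l xs → DownPath (binary c l r) (c ∷ xs)
    pr   : ∀ {c l r xs} → DownPath r xs → DownPath (binary c l r) (c ∷ xs)

  -- every non-empty simple path of a rooted tree has a highest vertex w;
  -- it either goes down from w, or goes up from the left subtree of w to w
  -- and then down into the right subtree of w.
  data PathAt : Tree k → List (Fin k) → Set where
    down  : ∀ {t xs} → DownPath t xs → PathAt t xs
    bend  : ∀ {c l r ys zs} → DownPath l ys → DownPath r zs →
            PathAt (binary c l r) (reverse ys ++ c ∷ zs)

  -- colour sequences of the non-empty simple paths of t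
  TreePath : Tree k → List (Fin k) → Set
  TreePath t xs = Σ (Tree k) λ u → Desc t u × PathAt u xs

  -- parity vertex colouring
  Proper : Tree k → Set
  Proper t = ∀ xs → TreePath t xs → Σ (Fin k) λ i → occ i xs % 2 ≡ 1

  Branched : Tree k → Set
  Branched (binary _ _ _) = ⊤
  Branched _              = ⊥

  IsLeaf : Tree k → Set
  IsLeaf (leaf _) = ⊤
  IsLeaf _        = ⊥

  Nice : Fin k → Tree k → Set
  Nice i t = Proper t × col t ≡ i ×
             (∀ u → Desc t u → Branched u → col u ≡ i) ×
             (∀ u → Desc t u → IsLeaf u → col u ≡ i)

  data SubAt : Tree k → Set where
    only : ∀ {t} → SubAt t
    sn   : ∀ {c t} → SubAt t → SubAt (unary c t)
    sl   : ∀ {c l r} → SubAt l → SubAt (binary c l r)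
    sr   : ∀ {c l r} → SubAt r → SubAt (binary c l r)
    slr  : ∀ {c l r} → SubAt l → SubAt r → SubAt (binary c l r)

  subTree : ∀ {t} → SubAt t → Tree k
  subTree {t} only = leaf (col t)
  subTree (sn {c} s) = unary c (subTree s)
  subTree (sl {c} s) = unary c (subTree s)
  subTree (sr {c} s) = unary c (subTree s)
  subTree (slr {c} s s') = binary c (subTree s) (subTree s')

  -- compatible subtrees of t: a vertex v of t (the root of the subtree)
  -- together with a subtree of T_v containing v, rooted at v
  Compat : Tree k → Set
  Compat t = Σ (Tree k) λ u → Desc t u × SubAt u

  cTree : ∀ {t} → Compat t → Tree k
  cTree (_ , _ , s) = subTree s

  -- the number of nicely coloured vertices of a nicely coloured tree with
  -- nice colour i is its number of vertices of colour i
  niceCount : Fin k → Tree k → ℕ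
  niceCount = countCol

record Choice (k : ℕ) : Set where
  field
    G     : Fin k → (t : Tree k) → Maybe (Compat t)
    G-nice : ∀ i t s → G i t ≡ just s → Nice i (cTree s)
    G-max  : ∀ i t s → G i t ≡ just s → ∀ (s' : Compat t) → Nice i (cTree s') →
             niceCount i (cTree s') ≤ niceCount i (cTree s)
    G-none : ∀ i t → G i t ≡ nothing → ∀ (s' : Compat t) → ¬ Nice i (cTree s')

module _ {k : ℕ} (ch : Choice k) where
  open Choice ch

  g : Fin k → Tree k → ℕ
  g i t with G i t
  ... | just s  = niceCount i (cTree s)
  ... | nothing = 0

  -- number of nicely coloured vertices of the original tree G of case (3)
  -- built from the root r (colour c) and its son s with subtree ts:
  -- r, the colour-c vertices strictly between r and the root of G_c(T_s),
  -- and the nicely coloured vertices of G_c(T_s).  If G_c(T_s) does not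
  -- exist, G is taken to be {r}.
  origCount : Fin k → Tree k → ℕ
  origCount c ts with G c ts
  ... | just (u , d , s) = 1 + descCount c d + niceCount c (subTree s)
  ... | nothing          = 1

  -- SaffCount t m : some admissible main safflower subgraph Saff(t) (for
  -- some tie-breaking) has exactly m nicely coloured vertices.
  data SaffCount : Tree k → ℕ → Set where
    case1  : ∀ {c} → SaffCount (leaf c) 1
    case2  : ∀ {c t m} → SaffCount t m → SaffCount (unary c t) (1 + m)
    case3l : ∀ {c l r m} → g c r ≤ g c l → SaffCount r m →
             SaffCount (binary c l r) (origCount c l + m)
    case3r : ∀ {c l r m} → g c l ≤ g c r → SaffCount l m →
             SaffCount (binary c l r) (origCount c r + m)

-- Subdivisions of the complete binary tree B_n (n layers), rooted at the
-- root of B_n.  Chain m t : a (possibly empty) path of subdivision vertices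
-- followed by a subdivision of B_m.

data SubdivB {k : ℕ} : ℕ → Tree k → Set
data Chain {k : ℕ} : ℕ → Tree k → Set

data SubdivB {k} where
  sbLeaf : ∀ {c} → SubdivB 1 (leaf c)
  sbNode : ∀ {m c l r} → Chain (suc m) l → Chain (suc m) r →
           SubdivB (suc (suc m)) (binary c l r)

data Chain {k} where
  cEnd  : ∀ {m t} → SubdivB m t → Chain m t
  cStep : ∀ {m c t} → Chain m t → Chain m (unary c t)

sumFin : (k : ℕ) → (Fin k → ℕ) → ℕ
sumFin zero    f = 0
sumFin (suc k) f = f zero + sumFin k (λ i → f (suc i))

sumBelow : ℕ → (ℕ → ℕ) → ℕ
sumBelow zero    f = 0
sumBelow (suc a) f = sumBelow a f + f a

module Submission where

-- Write F a = Σ_{j<a} 2^j, so F (a+1) = 2·F a + 1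
-- and 2^a = F a + 1.  We prove, by induction along the recursive definition
-- of Saff, a stronger statement: for a subdivision B* of B_n with Saff(B*)
-- having m nicely coloured vertices there is an "allocation" a : [k] → ℕ of
-- the n layers to the colours with Σ a_i = n, Σ F(a_i) ≤ m, and moreover
-- F(a_i) ≤ g_i(B*) for every colour i.  At a branched root r of colour c
-- whose smaller side t is followed by Saff, we raise a_c by one:
--   * the new original tree G has at least 1 + g_c(T_s) ≥ 1 + F(a_c) = 2^{a_c}
--     nicely coloured vertices, paying for the growth of Σ F(a_i);
--   * joining G_c(T_s) and G_c(T_t) at r gives g_c(T) ≥ 1 + g_c(T_s) + g_c(T_t)
--     ≥ 2·F(a_c) + 1 = F(a_c + 1), preserving the extra invariant.

open import Defs
open import Data.Nat using (ℕ; _≤_; _^_)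
open import Data.Fin using (Fin)
open import Data.Product using (Σ; _×_)
open import Relation.Binary.PropositionalEquality using (_≡_)

open import Data.Nat using (zero; suc; _+_; z≤n; s≤s)
open import Data.Nat.Properties
  using (≤-refl; ≤-trans; ≤-reflexive; +-mono-≤; +-monoˡ-≤; +-monoʳ-≤;
         +-comm; +-assoc; +-suc; +-identityʳ; m≤n+m; n≤1+n; module ≤-Reasoning)
open import Data.Fin using (zero; suc)
open import Data.Fin.Properties using (_≟_)
open import Data.Vec.Functional using (updateAt)
open import Data.Vec.Functional.Properties using (updateAt-updates; updateAt-minimal)
open import Data.Maybe using (Maybe; just; nothing)
open import Data.Product using (_,_; proj₂)
open import Data.Unit using (⊤; tt)
open import Data.Empty using (⊥-elim)
open import Relation.Nullary using (yes; no)
open import Relation.Binary.PropositionalEquality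
  using (refl; sym; trans; cong; module ≡-Reasoning)

module Trees {k : ℕ} where

  ind-refl : (i : Fin k) → ind i i ≡ 1
  ind-refl i with i ≟ i
  ... | yes _   = refl
  ... | no i≢i = ⊥-elim (i≢i refl)

  desc-trans : ∀ {t u v : Tree k} → Desc t u → Desc u v → Desc t v
  desc-trans here   e = e
  desc-trans (dn d) e = dn (desc-trans d e)
  desc-trans (dl d) e = dl (desc-trans d e)
  desc-trans (dr d) e = dr (desc-trans d e)

  proper-desc : ∀ {t u : Tree k} → Proper t → Desc t u → Proper u
  proper-desc p d xs (v , e , q) = p xs (v , desc-trans d e , q)

  downPath-sub : ∀ {t : Tree k} {xs} (s : SubAt t) →
                 DownPath (subTree s) xs → DownPath t xs
  downPath-sub only        stop   = stop
  downPath-sub (sn s)      stop   = stop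
  downPath-sub (sn s)      (pn q) = pn (downPath-sub s q)
  downPath-sub (sl s)      stop   = stop
  downPath-sub (sl s)      (pn q) = pl (downPath-sub s q)
  downPath-sub (sr s)      stop   = stop
  downPath-sub (sr s)      (pn q) = pr (downPath-sub s q)
  downPath-sub (slr s s')  stop   = stop
  downPath-sub (slr s s')  (pl q) = pl (downPath-sub s q)
  downPath-sub (slr s s')  (pr q) = pr (downPath-sub s' q)

  path-sub : ∀ {t : Tree k} {xs} (s : SubAt t) →
             PathAt (subTree s) xs → PathAt t xs
  path-sub only        (down q)    = down (downPath-sub only q)
  path-sub (sn s)      (down q)    = down (downPath-sub (sn s) q)
  path-sub (sl s)      (down q)    = down (downPath-sub (sl s) q)
  path-sub (sr s)      (down q)    = down (downPath-sub (sr s) q)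
  path-sub (slr s s')  (down q)    = down (downPath-sub (slr s s') q)
  path-sub (slr s s')  (bend q q') = bend (downPath-sub s q) (downPath-sub s' q')

  desc-sub : ∀ {t u : Tree k} (s : SubAt t) → Desc (subTree s) u →
             Σ (Tree k) λ t' → Σ (SubAt t') λ s' → Desc t t' × subTree s' ≡ u
  desc-sub only       here = _ , only , here , refl
  desc-sub (sn s)     here = _ , sn s , here , refl
  desc-sub (sl s)     here = _ , sl s , here , refl
  desc-sub (sr s)     here = _ , sr s , here , refl
  desc-sub (slr s s') here = _ , slr s s' , here , refl
  desc-sub (sn s) (dn d) with desc-sub s d
  ... | t' , s' , d' , e = t' , s' , dn d' , e
  desc-sub (sl s) (dn d) with desc-sub s d
  ... | t' , s' , d' , e = t' , s' , dl d' , e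
  desc-sub (sr s) (dn d) with desc-sub s d
  ... | t' , s' , d' , e = t' , s' , dr d' , e
  desc-sub (slr s s₁) (dl d) with desc-sub s d
  ... | t' , s' , d' , e = t' , s' , dl d' , e
  desc-sub (slr s s₁) (dr d) with desc-sub s₁ d
  ... | t' , s' , d' , e = t' , s' , dr d' , e

  proper-sub : ∀ {t : Tree k} → Proper t → (s : SubAt t) → Proper (subTree s)
  proper-sub p s xs (u , d , q) with desc-sub s d
  ... | t' , s' , d' , refl = p xs (t' , d' , path-sub s' q)

  NiceShape : Fin k → Tree k → Set
  NiceShape i t = (∀ u → Desc t u → Branched u → col u ≡ i) ×
                  (∀ u → Desc t u → IsLeaf u → col u ≡ i)

  leaf-shape : ∀ i → NiceShape i (leaf i)
  leaf-shape i = (λ { u here () }) , (λ { u here _ → refl })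

  unary-shape : ∀ {i} {t : Tree k} c → NiceShape i t → NiceShape i (unary c t)
  unary-shape c (br , lf) = (λ { u here () ; u (dn d) b → br u d b })
                          , (λ { u here () ; u (dn d) b → lf u d b })

  binary-shape : ∀ {i} {l r : Tree k} →
                 NiceShape i l → NiceShape i r → NiceShape i (binary i l r)
  binary-shape (br , lf) (br' , lf') =
      (λ { u here _ → refl ; u (dl d) b → br u d b ; u (dr d) b → br' u d b })
    , (λ { u here () ; u (dl d) b → lf u d b ; u (dr d) b → lf' u d b })

  -- A subtree rooted at a descendant u, extended by the path from the root
  -- of t down to u (the tree G of case (3) of the definition of Saff).
  extend : ∀ {t u : Tree k} → Desc t u → SubAt u → SubAt t
  extend here   s = s
  extend (dn d) s = sn (extend d s)
  extend (dl d) s = sl (extend d s)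
  extend (dr d) s = sr (extend d s)

  extend-shape : ∀ {i} {t u : Tree k} (d : Desc t u) (s : SubAt u) →
                 NiceShape i (subTree s) → NiceShape i (subTree (extend d s))
  extend-shape here       s sh = sh
  extend-shape (dn {c} d) s sh = unary-shape c (extend-shape d s sh)
  extend-shape (dl {c} d) s sh = unary-shape c (extend-shape d s sh)
  extend-shape (dr {c} d) s sh = unary-shape c (extend-shape d s sh)

  prepend-count : ∀ (i c : Fin k) {x y z : ℕ} → x ≡ y + z → ind i c + x ≡ ind i c + y + z
  prepend-count i c eq = trans (cong (ind i c +_) eq) (sym (+-assoc (ind i c) _ _))

  extend-count : ∀ {t u : Tree k} i (d : Desc t u) (s : SubAt u) →
                 countCol i (subTree (extend d s)) ≡ descCount i d + countCol i (subTree s)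
  extend-count i here       s = refl
  extend-count i (dn {c} d) s = prepend-count i c (extend-count i d s)
  extend-count i (dl {c} d) s = prepend-count i c (extend-count i d s)
  extend-count i (dr {c} d) s = prepend-count i c (extend-count i d s)

  optCount : ∀ {t : Tree k} → Fin k → Maybe (SubAt t) → ℕ
  optCount i nothing  = 0
  optCount i (just s) = countCol i (subTree s)

  OptShape : ∀ {t : Tree k} → Fin k → Maybe (SubAt t) → Set
  OptShape i nothing  = ⊤
  OptShape i (just s) = NiceShape i (subTree s)

  join : ∀ {c} {l r : Tree k} → Maybe (SubAt l) → Maybe (SubAt r) → SubAt (binary c l r)
  join nothing  nothing  = only
  join (just s) nothing  = sl s
  join nothing  (just s) = sr s
  join (just s) (just s') = slr s s'

  join-root : ∀ {c} {l r : Tree k} (ml : Maybe (SubAt l)) (mr : Maybe (SubAt r)) →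
              col (subTree (join {c} ml mr)) ≡ c
  join-root nothing  nothing   = refl
  join-root (just s) nothing   = refl
  join-root nothing  (just s)  = refl
  join-root (just s) (just s') = refl

  join-shape : ∀ {c} {l r : Tree k} (ml : Maybe (SubAt l)) (mr : Maybe (SubAt r)) →
               OptShape c ml → OptShape c mr → NiceShape c (subTree (join {c} ml mr))
  join-shape {c} nothing  nothing  _  _  = leaf-shape c
  join-shape {c} (just s) nothing  sh _  = unary-shape c sh
  join-shape {c} nothing  (just s) _  sh = unary-shape c sh
  join-shape     (just s) (just s') sh sh' = binary-shape sh sh'

  join-count : ∀ {c} {l r : Tree k} (ml : Maybe (SubAt l)) (mr : Maybe (SubAt r)) →
               countCol c (subTree (join {c} ml mr)) ≡ ind c c + optCount c ml + optCount c mr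
  join-count {c} nothing  nothing  = sym (trans (+-identityʳ (ind c c + 0)) (+-identityʳ (ind c c)))
  join-count     (just s) nothing  = sym (+-identityʳ _)
  join-count {c} nothing  (just s) = sym (cong (_+ countCol c (subTree s)) (+-identityʳ (ind c c)))
  join-count     (just s) (just s') = refl

module Greedy {k : ℕ} (ch : Choice k) where
  open Choice ch
  open Trees {k}

  g-max : ∀ {i t} (s : Compat t) → Nice i (cTree s) → niceCount i (cTree s) ≤ g ch i t
  g-max {i} {t} s nice with G i t in eq
  ... | just s₀ = G-max i t s₀ eq s nice
  ... | nothing = ⊥-elim (G-none i t eq s nice)

  -- g is monotone along descent: compatible subtrees of T_u are compatible in T.
  g-desc : ∀ {i} {t u : Tree k} → Desc t u → g ch i u ≤ g ch i t
  g-desc {i} {t} {u} d with G i u in eq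
  ... | just (v , e , s) = g-max (v , desc-trans d e , s) (G-nice i u _ eq)
  ... | nothing          = z≤n

  -- The root alone is a nicely coloured tree in its own colour.
  g-root : ∀ {t : Tree k} → Proper t → 1 ≤ g ch (col t) t
  g-root {t} p = ≤-trans (≤-reflexive (sym (ind-refl (col t))))
                         (g-max (t , here , only) (proper-sub p only , refl , leaf-shape (col t)))

  -- g_i(t) is attained by a possibly empty nicely shaped subtree at the root
  -- of t: G_i(t) extended up to the root.
  g-attained : ∀ i (t : Tree k) →
               Σ (Maybe (SubAt t)) λ ms → OptShape i ms × g ch i t ≤ optCount i ms
  g-attained i t with G i t in eq
  ... | just (u , d , s) =
          just (extend d s) , extend-shape d s (proj₂ (proj₂ (G-nice i t _ eq)))
        , ≤-trans (m≤n+m _ (descCount i d)) (≤-reflexive (sym (extend-count i d s)))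
  ... | nothing = nothing , tt , z≤n

  -- Joining the optimal trees of both sons at a root of colour c:
  -- g_c(T) ≥ 1 + g_c(T_l) + g_c(T_r).
  g-join : ∀ c (l r : Tree k) → Proper (binary c l r) →
           suc (g ch c l + g ch c r) ≤ g ch c (binary c l r)
  g-join c l r p with g-attained c l | g-attained c r
  ... | ml , shl , gl | mr , shr , gr = begin
      suc (g ch c l + g ch c r)                   ≤⟨ s≤s (+-mono-≤ gl gr) ⟩
      1 + optCount c ml + optCount c mr           ≡⟨ cong (λ x → x + optCount c ml + optCount c mr)
                                                          (sym (ind-refl c)) ⟩
      ind c c + optCount c ml + optCount c mr     ≡⟨ sym (join-count ml mr) ⟩
      countCol c (subTree (join {c} ml mr))       ≤⟨ g-max (_ , here , join ml mr) joined-nice ⟩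
      g ch c (binary c l r)                       ∎
    where
      open ≤-Reasoning
      joined-nice : Nice c (subTree (join {c} ml mr))
      joined-nice = proper-sub p (join ml mr) , join-root ml mr , join-shape ml mr shl shr

  origCount-bound : ∀ c (s : Tree k) → suc (g ch c s) ≤ origCount ch c s
  origCount-bound c s with G c s
  ... | just (u , d , t) = s≤s (m≤n+m _ (descCount c d))
  ... | nothing          = ≤-refl

-- F a = Σ_{j<a} 2^j, the least number of nicely coloured vertices
-- accounted for by a layers of a single colour.
F : ℕ → ℕ
F a = sumBelow a (λ j → 2 ^ j)

F-pow : ∀ a → suc (F a) ≡ 2 ^ a
F-pow zero    = refl
F-pow (suc a) = trans (cong (_+ 2 ^ a) (F-pow a)) (cong (2 ^ a +_) (sym (+-identityʳ (2 ^ a))))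

F-suc : ∀ a → F (suc a) ≡ suc (F a + F a)
F-suc a = trans (cong (F a +_) (sym (F-pow a))) (+-suc (F a) (F a))

sumFin-updateAt : ∀ {k} (f u : ℕ → ℕ) (a : Fin k → ℕ) (c : Fin k) {d : ℕ} →
                  f (u (a c)) ≡ f (a c) + d →
                  sumFin k (λ i → f (updateAt a c u i)) ≡ sumFin k (λ i → f (a i)) + d
sumFin-updateAt {suc k} f u a zero {d} eq = begin
    f (u (a zero)) + S    ≡⟨ cong (_+ S) eq ⟩
    f (a zero) + d + S    ≡⟨ +-assoc (f (a zero)) d S ⟩
    f (a zero) + (d + S)  ≡⟨ cong (f (a zero) +_) (+-comm d S) ⟩
    f (a zero) + (S + d)  ≡⟨ sym (+-assoc (f (a zero)) S d) ⟩
    f (a zero) + S + d    ∎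
  where
    open ≡-Reasoning
    S = sumFin k (λ i → f (a (suc i)))
sumFin-updateAt {suc k} f u a (suc c) eq =
  trans (cong (f (a zero) +_) (sumFin-updateAt f u (λ i → a (suc i)) c eq))
        (sym (+-assoc (f (a zero)) _ _))

sumFin-zero : ∀ k → sumFin k (λ _ → 0) ≡ 0
sumFin-zero zero    = refl
sumFin-zero (suc k) = sumFin-zero k

Allocation : (k : ℕ) → (Fin k → ℕ) → ℕ → ℕ → Set
Allocation k h n m = Σ (Fin k → ℕ) λ a →
  sumFin k a ≡ n × sumFin k (λ i → F (a i)) ≤ m × (∀ i → F (a i) ≤ h i)

module _ {k : ℕ} where

  allocation-empty : Allocation k (λ _ → 0) 0 0
  allocation-empty = (λ _ → 0) , sumFin-zero k , ≤-reflexive (sumFin-zero k) , (λ _ → z≤n)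

  allocation-weaken : ∀ {h h' : Fin k → ℕ} {n m m'} → Allocation k h n m →
                      (∀ i → h i ≤ h' i) → m ≤ m' → Allocation k h' n m'
  allocation-weaken (a , sum-a , le , bd) hh mm =
    a , sum-a , ≤-trans le mm , (λ i → ≤-trans (bd i) (hh i))

  -- Giving one more layer to colour c costs 2^{a_c} ≤ 1 + h c in Σ F(a_i),
  -- and keeps F(a_c) bounded provided the bound h' c at least doubles h c.
  allocation-grow : ∀ {h h' : Fin k → ℕ} {n m e} → Allocation k h n m → (c : Fin k) →
                    (∀ i → h i ≤ h' i) → suc (h c + h c) ≤ h' c → suc (h c) ≤ e →
                    Allocation k h' (suc n) (e + m)
  allocation-grow {h} {h'} {n} {m} {e} (a , sum-a , le , bd) c hh doubling cost =
    updateAt a c suc , sum-a' , le' , bd'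
    where
      sum-a' : sumFin k (updateAt a c suc) ≡ suc n
      sum-a' = trans (sumFin-updateAt (λ x → x) suc a c (+-comm 1 (a c)))
                     (trans (cong (_+ 1) sum-a) (+-comm n 1))

      le' : sumFin k (λ i → F (updateAt a c suc i)) ≤ e + m
      le' = begin
        sumFin k (λ i → F (updateAt a c suc i)) ≡⟨ sumFin-updateAt F suc a c refl ⟩
        sumFin k (λ i → F (a i)) + 2 ^ a c      ≤⟨ +-mono-≤ le pow≤e ⟩
        m + e                                   ≡⟨ +-comm m e ⟩
        e + m                                   ∎
        where
          open ≤-Reasoning
          pow≤e : 2 ^ a c ≤ e
          pow≤e = ≤-trans (≤-reflexive (sym (F-pow (a c)))) (≤-trans (s≤s (bd c)) cost)

      bd' : ∀ i → F (updateAt a c suc i) ≤ h' i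
      bd' i with i ≟ c
      ... | no i≢c  = ≤-trans (≤-reflexive (cong F (updateAt-minimal i c a i≢c)))
                              (≤-trans (bd i) (hh i))
      ... | yes refl = begin
        F (updateAt a i suc i)  ≡⟨ cong F (updateAt-updates i a) ⟩
        F (suc (a i))           ≡⟨ F-suc (a i) ⟩
        suc (F (a i) + F (a i)) ≤⟨ s≤s (+-mono-≤ (bd i) (bd i)) ⟩
        suc (h i + h i)         ≤⟨ doubling ⟩
        h' i                    ∎
        where open ≤-Reasoning

module Safflower {k : ℕ} (ch : Choice k) where
  open Trees {k}
  open Greedy ch

  subdiv-allocation : ∀ {n t m} → SubdivB n t → Proper t → SaffCount ch t m →
                      Allocation k (λ i → g ch i t) n m
  chain-allocation  : ∀ {n t m} → Chain n t → Proper t → SaffCount ch t m →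
                      Allocation k (λ i → g ch i t) n m

  subdiv-allocation (sbLeaf {c}) p case1 =
    allocation-grow allocation-empty c (λ _ → z≤n) (g-root p) ≤-refl
  subdiv-allocation (sbNode {c = c} {l} {r} _ cr) p (case3l g-r≤g-l saff) =
    allocation-grow (chain-allocation cr (proper-desc p (dr here)) saff) c
      (λ _ → g-desc (dr here))
      (≤-trans (s≤s (+-monoˡ-≤ (g ch c r) g-r≤g-l)) (g-join c l r p))
      (≤-trans (s≤s g-r≤g-l) (origCount-bound c l))
  subdiv-allocation (sbNode {c = c} {l} {r} cl _) p (case3r g-l≤g-r saff) =
    allocation-grow (chain-allocation cl (proper-desc p (dl here)) saff) c
      (λ _ → g-desc (dl here))
      (≤-trans (s≤s (+-monoʳ-≤ (g ch c l) g-l≤g-r)) (g-join c l r p))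
      (≤-trans (s≤s g-l≤g-r) (origCount-bound c r))

  chain-allocation (cEnd sb)    p saff          = subdiv-allocation sb p saff
  chain-allocation (cStep cs)   p (case2 saff) =
    allocation-weaken (chain-allocation cs (proper-desc p (dn here)) saff)
      (λ _ → g-desc (dn here)) (n≤1+n _)

lemma10 : (k n : ℕ) → 1 ≤ k → 1 ≤ n → (ch : Choice k) →
    (B : Tree k) → SubdivB n B → Proper B →
    (m : ℕ) → SaffCount ch B m →
    Σ (Fin k → ℕ) λ a →
    sumFin k a ≡ n ×
    sumFin k (λ i → sumBelow (a i) (λ j → 2 ^ j)) ≤ m
lemma10 k n _ _ ch B sb p m saff
  with Safflower.subdiv-allocation ch sb p saff
... | a , sum-a , weighted-sum , _ = a , sum-a , weighted-sum
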